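{- Suppose that $u>1$, $s$ and $t$ are integers, $n=3^u$, $1 \leq s,t \leq n/2$, and $s \neq t$. Then $\chi(C_n, \{s,t\})=3$.
   Context: $C_n$ is the cycle with vertex set $\mathbb{Z}_n=\{0,1,\dots,n-1\}$, $i$ adjacent to $i\pm1 \pmod n$; the graph distance is $\mathrm{dist}(i,j)=\min(|i-j|,\,n-|i-j|)$. For a set $D$ of positive integers, the distance graph $G(C_n,D)$ has vertex set $\mathbb{Z}_n$, with distinct $i,j$ adjacent iff $\mathrm{dist}(i,j)\in D$; $\chi(C_n,D)$ is its chromatic number. -}

module Defs where

open import Data.Nat using (ℕ; _+_; _*_; _∸_; _^_; _<_; _⊔_; _⊓_)
open import Data.Fin using (Fin; toℕ)
open import Data.Product using (_×_; Σ)
open import Relation.Binary.PropositionalEquality using (_≡_; _≢_)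
open import Data.Sum using (_⊎_)
open import Relation.Nullary using (¬_)

absDiff : ℕ → ℕ → ℕ
absDiff a b = (a ∸ b) ⊔ (b ∸ a)

cdist : (n : ℕ) → Fin n → Fin n → ℕ
cdist n i j = absDiff (toℕ i) (toℕ j) ⊓ (n ∸ absDiff (toℕ i) (toℕ j))

Adj : (n : ℕ) → (D : ℕ → Set) → Fin n → Fin n → Set
Adj n D i j = (i ≢ j) × D (cdist n i j)

Colorable : (n : ℕ) → (D : ℕ → Set) → ℕ → Set
Colorable n D k = Σ (Fin n → Fin k) λ c → ∀ i j → Adj n D i j → c i ≢ c j

ChromaticNumber : (n : ℕ) → (D : ℕ → Set) → ℕ → Set
ChromaticNumber n D k = Colorable n D k × (∀ m → m < k → ¬ Colorable n D m)

Pair : ℕ → ℕ → ℕ → Set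
Pair s t d = (d ≡ s) ⊎ (d ≡ t)

-- Colour vertex i by the third [0, N), [N, 2N) or [2N, 3N) of ℤ_{3N} containing k·i, where 3N
-- divides n: vertices at distance d then get different colours whenever k·d lies in the middle
-- third modulo 3N. Write s = 3^a s′ and t = 3^b t′ with 3 ∤ s′, t′ and a ≤ b, take N = 3^b, and
-- choose k with k s′ ≡ 3^(b-a) + 1 modulo 3^(b-a+1) (s′ is invertible there); then
-- k s ≡ 3^b + 3^a and k t ≡ ±3^b modulo 3^(b+1). Two colours do not suffice: the closed walk
-- 0, s, 2s, …, ns moves by distance s at every step, so its colours alternate, yet its length
-- n = 3^u is odd.
module Submission where

open import Defs
open import Data.Nat using (ℕ; _<_; _≤_; _*_; _^_)
open import Relation.Binary.PropositionalEquality using (_≢_)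

open import Data.Fin using (Fin; zero; suc; toℕ; fromℕ<; inject≤)
open import Data.Fin.Properties using (toℕ<n; toℕ-injective; toℕ-fromℕ<; inject≤-injective)
open import Data.Nat
  using (NonZero; zero; suc; z≤n; s≤s; _+_; _∸_; _⊓_; _⊔_; _%_; _/_; _<?_; >-nonZero; >-nonZero⁻¹)
open import Data.Nat.Coprimality using (Coprime; coprime-Bézout; coprime-divisor)
open import Data.Nat.DivMod
open import Data.Nat.Divisibility
open import Data.Nat.GCD using (module Bézout)
open import Data.Nat.GeneralisedArithmetic using (fold)
open import Data.Nat.Induction using (<-wellFounded)
open import Data.Nat.Primality using (Prime; prime?; prime⇒irreducible; euclidsLemma)
open import Data.Nat.Properties
open import Data.Nat.Tactic.RingSolver using (solve-∀)
open import Data.Product using (∃; ∃₂; _×_; _,_)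
open import Data.Sum using (_⊎_; inj₁; inj₂)
import Data.Sum as Sum
open import Function using (_∘_)
open import Induction.WellFounded using (Acc; acc)
open import Relation.Binary.PropositionalEquality
open import Relation.Nullary using (¬_; yes; no; contradiction)
open import Relation.Nullary.Decidable using (from-yes)

m%n+n≡m : ∀ {m n} .{{_ : NonZero n}} → n ≤ m → m < n + n → m % n + n ≡ m
m%n+n≡m {m} {n} n≤m m<2n = begin
  m % n + n           ≡⟨ cong (λ z → z % n + n) (sym (m∸n+n≡m n≤m)) ⟩
  (m ∸ n + n) % n + n ≡⟨ cong (_+ n) ([m+n]%n≡m%n (m ∸ n) n) ⟩
  (m ∸ n) % n + n     ≡⟨ cong (_+ n) (m<n⇒m%n≡m m∸n<n) ⟩
  m ∸ n + n           ≡⟨ m∸n+n≡m n≤m ⟩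
  m                   ∎
  where
  open ≡-Reasoning
  m∸n<n : m ∸ n < n
  m∸n<n = +-cancelʳ-< n (m ∸ n) n (subst (_< n + n) (sym (m∸n+n≡m n≤m)) m<2n)

[m%n+o]%n≡[m+o]%n : ∀ m n o .{{_ : NonZero n}} → (m % n + o) % n ≡ (m + o) % n
[m%n+o]%n≡[m+o]%n m n o = begin
  (m % n + o) % n         ≡⟨ %-distribˡ-+ (m % n) o n ⟩
  (m % n % n + o % n) % n ≡⟨ cong (λ z → (z + o % n) % n) (m%n%n≡m%n m n) ⟩
  (m % n + o % n) % n     ≡⟨ %-distribˡ-+ m o n ⟨
  (m + o) % n             ∎
  where open ≡-Reasoning

%-cong-*ˡ : ∀ k {a b} n .{{_ : NonZero n}} → a % n ≡ b % n → (k * a) % n ≡ (k * b) % n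
%-cong-*ˡ k {a} {b} n a≡b = begin
  (k * a) % n             ≡⟨ %-distribˡ-* k a n ⟩
  (k % n * (a % n)) % n   ≡⟨ cong (λ z → (k % n * z) % n) a≡b ⟩
  (k % n * (b % n)) % n   ≡⟨ %-distribˡ-* k b n ⟨
  (k * b) % n             ∎
  where open ≡-Reasoning

%-cong-∣ : ∀ {m n a b} .{{_ : NonZero m}} .{{_ : NonZero n}} →
           m ∣ n → a % n ≡ b % n → a % m ≡ b % m
%-cong-∣ {m} {n} {a} {b} m∣n a≡b = begin
  a % m     ≡⟨ m∣n⇒o%n%m≡o%m m n a m∣n ⟨
  a % n % m ≡⟨ cong (_% m) a≡b ⟩
  b % n % m ≡⟨ m∣n⇒o%n%m≡o%m m n b m∣n ⟩
  b % m     ∎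
  where open ≡-Reasoning

%-shift-cases : ∀ n .{{_ : NonZero n}} a b c → (a + b) % n ≡ c % n →
                a % n + b % n ≡ c % n ⊎ a % n + b % n ≡ c % n + n
%-shift-cases n a b c a+b≡c = cases (trans (sym (%-distribˡ-+ a b n)) a+b≡c)
  where
  cases : (a % n + b % n) % n ≡ c % n → a % n + b % n ≡ c % n ⊎ a % n + b % n ≡ c % n + n
  cases sum≡c with a % n + b % n <? n
  ... | yes no-wrap = inj₁ (trans (sym (m<n⇒m%n≡m no-wrap)) sum≡c)
  ... | no wrap     = inj₂ (trans (sym (m%n+n≡m (≮⇒≥ wrap) (+-mono-< (m%n<n a n) (m%n<n b n))))
                                  (cong (_+ n) sum≡c))

absDiff-≤ : ∀ {x y} → x ≤ y → absDiff x y ≡ y ∸ x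
absDiff-≤ x≤y rewrite m≤n⇒m∸n≡0 x≤y = refl

absDiff-comm : ∀ x y → absDiff x y ≡ absDiff y x
absDiff-comm x y = ⊔-comm (x ∸ y) (y ∸ x)

cycle-norm : ℕ → ℕ → ℕ
cycle-norm n z = z ⊓ (n ∸ z)

cdist≢0⇒≢ : ∀ n (i j : Fin n) → cdist n i j ≢ 0 → i ≢ j
cdist≢0⇒≢ n i .i d≢0 refl = d≢0 (cong (λ z → cycle-norm n (z ⊔ z)) (n∸n≡0 (toℕ i)))

shift-of-distance : ∀ n .{{_ : NonZero n}} {x y d} → x ≤ y → y ≤ n → cycle-norm n (y ∸ x) ≡ d →
                    (x + d) % n ≡ y % n ⊎ (y + d) % n ≡ x % n
shift-of-distance n {x} {y} x≤y y≤n refl with ⊓-sel (y ∸ x) (n ∸ (y ∸ x))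
... | inj₁ norm≡y∸x = inj₁ (cong (_% n) (trans (cong (x +_) norm≡y∸x) (m+[n∸m]≡n x≤y)))
... | inj₂ norm≡n∸[y∸x] = inj₂ (begin
  (y + cycle-norm n (y ∸ x)) % n ≡⟨ cong (λ z → (y + z) % n) norm≡n∸[y∸x] ⟩
  (y + (n ∸ (y ∸ x))) % n        ≡⟨ cong (_% n) wraps ⟩
  (x + n) % n                    ≡⟨ [m+n]%n≡m%n x n ⟩
  x % n                          ∎)
  where
  open ≡-Reasoning
  wraps : y + (n ∸ (y ∸ x)) ≡ x + n
  wraps = begin
    y + (n ∸ (y ∸ x))           ≡⟨ cong (_+ (n ∸ (y ∸ x))) (m+[n∸m]≡n x≤y) ⟨
    x + (y ∸ x) + (n ∸ (y ∸ x)) ≡⟨ +-assoc x (y ∸ x) (n ∸ (y ∸ x)) ⟩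
    x + (y ∸ x + (n ∸ (y ∸ x))) ≡⟨ cong (x +_) (m+[n∸m]≡n (≤-trans (m∸n≤m y x) y≤n)) ⟩
    x + n                       ∎

cdist⇒shift : ∀ n .{{_ : NonZero n}} (i j : Fin n) →
              (toℕ i + cdist n i j) % n ≡ toℕ j % n ⊎ (toℕ j + cdist n i j) % n ≡ toℕ i % n
cdist⇒shift n i j with ≤-total (toℕ i) (toℕ j)
... | inj₁ i≤j = shift-of-distance n i≤j (<⇒≤ (toℕ<n j)) (cong (cycle-norm n) (sym (absDiff-≤ i≤j)))
... | inj₂ j≤i = Sum.swap (shift-of-distance n j≤i (<⇒≤ (toℕ<n i)) (cong (cycle-norm n) j-i≡∣i-j∣))
  where
  j-i≡∣i-j∣ : toℕ i ∸ toℕ j ≡ absDiff (toℕ i) (toℕ j)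
  j-i≡∣i-j∣ = sym (trans (absDiff-comm (toℕ i) (toℕ j)) (absDiff-≤ j≤i))

shift⇒cdist : ∀ n .{{_ : NonZero n}} d (i j : Fin n) →
              d ≤ n ∸ d → toℕ j ≡ (toℕ i + d) % n → cdist n i j ≡ d
shift⇒cdist n d i j d≤n∸d j≡i+d with toℕ i + d <? n
... | yes no-wrap = begin
  cdist n i j                  ≡⟨ cong (cycle-norm n) (absDiff-≤ i≤j) ⟩
  cycle-norm n (toℕ j ∸ toℕ i) ≡⟨ cong (cycle-norm n) j-i≡d ⟩
  d ⊓ (n ∸ d)                  ≡⟨ m≤n⇒m⊓n≡m d≤n∸d ⟩
  d                            ∎
  where
  open ≡-Reasoning
  j≡i+d′ : toℕ j ≡ toℕ i + d
  j≡i+d′ = trans j≡i+d (m<n⇒m%n≡m no-wrap)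
  i≤j : toℕ i ≤ toℕ j
  i≤j = subst (toℕ i ≤_) (sym j≡i+d′) (m≤m+n (toℕ i) d)
  j-i≡d : toℕ j ∸ toℕ i ≡ d
  j-i≡d = trans (cong (_∸ toℕ i) j≡i+d′) (m+n∸m≡n (toℕ i) d)
... | no wrap = begin
  cdist n i j                      ≡⟨ cong (cycle-norm n) ∣i-j∣≡n∸d ⟩
  (n ∸ d) ⊓ (n ∸ (n ∸ d))          ≡⟨ cong ((n ∸ d) ⊓_) (m∸[m∸n]≡n d≤n) ⟩
  (n ∸ d) ⊓ d                      ≡⟨ ⊓-comm (n ∸ d) d ⟩
  d ⊓ (n ∸ d)                      ≡⟨ m≤n⇒m⊓n≡m d≤n∸d ⟩
  d                                ∎
  where
  open ≡-Reasoning
  d≤n : d ≤ n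
  d≤n = ≤-trans d≤n∸d (m∸n≤m n d)
  j+n≡i+d : toℕ j + n ≡ toℕ i + d
  j+n≡i+d = trans (cong (_+ n) j≡i+d) (m%n+n≡m (≮⇒≥ wrap) (+-mono-<-≤ (toℕ<n i) d≤n))
  j+[n∸d]≡i : toℕ j + (n ∸ d) ≡ toℕ i
  j+[n∸d]≡i = +-cancelʳ-≡ d _ _ (begin
    toℕ j + (n ∸ d) + d   ≡⟨ +-assoc (toℕ j) (n ∸ d) d ⟩
    toℕ j + (n ∸ d + d)   ≡⟨ cong (toℕ j +_) (m∸n+n≡m d≤n) ⟩
    toℕ j + n             ≡⟨ j+n≡i+d ⟩
    toℕ i + d             ∎)
  j≤i : toℕ j ≤ toℕ i
  j≤i = subst (toℕ j ≤_) j+[n∸d]≡i (m≤m+n (toℕ j) (n ∸ d))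
  ∣i-j∣≡n∸d : absDiff (toℕ i) (toℕ j) ≡ n ∸ d
  ∣i-j∣≡n∸d = begin
    absDiff (toℕ i) (toℕ j)  ≡⟨ absDiff-comm (toℕ i) (toℕ j) ⟩
    absDiff (toℕ j) (toℕ i)  ≡⟨ absDiff-≤ j≤i ⟩
    toℕ i ∸ toℕ j            ≡⟨ cong (_∸ toℕ j) j+[n∸d]≡i ⟨
    toℕ j + (n ∸ d) ∸ toℕ j  ≡⟨ m+n∸m≡n (toℕ j) (n ∸ d) ⟩
    n ∸ d                    ∎

3N≡2N+N : ∀ N → 3 * N ≡ N + N + N
3N≡2N+N = solve-∀

arc : ℕ → ℕ → Fin 3
arc N x with x <? N | x <? N + N
... | yes _ | _     = zero
... | no _  | yes _ = suc zero
... | no _  | no _  = suc (suc zero)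

same-arc⇒< : ∀ N x y → x < 3 * N → arc N x ≡ arc N y → x < y + N
same-arc⇒< N x y x<3N same with x <? N | x <? N + N | y <? N | y <? N + N
... | yes x<N | _        | _      | _       = ≤-trans x<N (m≤n+m N y)
... | no _    | yes x<2N | no y≮N | _       = ≤-trans x<2N (+-monoˡ-≤ N (≮⇒≥ y≮N))
... | no _    | no _     | no _   | no y≮2N =
  <-≤-trans x<3N (subst (_≤ y + N) (sym (3N≡2N+N N)) (+-monoˡ-≤ N (≮⇒≥ y≮2N)))
... | no _    | yes _    | yes _  | _       = contradiction same λ ()
... | no _    | no _     | yes _  | _       = contradiction same λ ()
... | no _    | no _     | no _   | yes _   = contradiction same λ ()

Middle : ℕ → ℕ → Set
Middle N d = ∃₂ λ q r → d ≡ r + q * (3 * N) × N ≤ r × r ≤ N + N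

middle-residue : ∀ N .{{_ : NonZero (3 * N)}} d → Middle N d →
                 N ≤ d % (3 * N) × d % (3 * N) ≤ N + N
middle-residue N d (q , r , refl , N≤r , r≤2N) =
  subst (N ≤_) (sym r%3N≡r) N≤r , subst (_≤ N + N) (sym r%3N≡r) r≤2N
  where
  2N<3N : N + N < 3 * N
  2N<3N = begin-strict
    N + N     <⟨ m<m+n (N + N) (>-nonZero⁻¹ N {{m*n≢0⇒n≢0 3}}) ⟩
    N + N + N ≡⟨ 3N≡2N+N N ⟨
    3 * N     ∎
    where open ≤-Reasoning
  r%3N≡r : (r + q * (3 * N)) % (3 * N) ≡ r
  r%3N≡r = trans ([m+kn]%n≡m%n r q (3 * N)) (m<n⇒m%n≡m (≤-<-trans r≤2N 2N<3N))

arcs-separate : ∀ N x y δ → x < 3 * N → y < 3 * N → N ≤ δ → δ ≤ N + N →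
                x + δ ≡ y ⊎ x + δ ≡ y + 3 * N → arc N x ≢ arc N y
arcs-separate N x y δ x<3N y<3N N≤δ δ≤2N (inj₁ x+δ≡y) same = <-irrefl refl (begin-strict
  y          <⟨ same-arc⇒< N y x y<3N (sym same) ⟩
  x + N      ≤⟨ +-monoʳ-≤ x N≤δ ⟩
  x + δ      ≡⟨ x+δ≡y ⟩
  y          ∎)
  where open ≤-Reasoning
arcs-separate N x y δ x<3N y<3N N≤δ δ≤2N (inj₂ x+δ≡y+3N) same = <-irrefl refl (begin-strict
  x + δ           <⟨ +-monoˡ-< δ (same-arc⇒< N x y x<3N same) ⟩
  y + N + δ       ≤⟨ +-monoʳ-≤ (y + N) δ≤2N ⟩
  y + N + (N + N) ≡⟨ y+N+2N≡y+3N y N ⟩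
  y + 3 * N       ≡⟨ x+δ≡y+3N ⟨
  x + δ           ∎)
  where
  open ≤-Reasoning
  y+N+2N≡y+3N : ∀ y N → y + N + (N + N) ≡ y + 3 * N
  y+N+2N≡y+3N = solve-∀

arc-shift-≢ : ∀ N .{{_ : NonZero (3 * N)}} x y d → (x + d) % (3 * N) ≡ y % (3 * N) → Middle N d →
              arc N (x % (3 * N)) ≢ arc N (y % (3 * N))
arc-shift-≢ N x y d x+d≡y middle =
  let N≤δ , δ≤2N = middle-residue N d middle in
  arcs-separate N _ _ _ (m%n<n x (3 * N)) (m%n<n y (3 * N)) N≤δ δ≤2N (%-shift-cases (3 * N) x d y x+d≡y)

colorable-by-arcs : ∀ n D N k .{{_ : NonZero n}} .{{_ : NonZero (3 * N)}} → 3 * N ∣ n →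
                    (∀ d → D d → Middle N (k * d)) → Colorable n D 3
colorable-by-arcs n D N k 3N∣n middle = colour , proper
  where
  colour : Fin n → Fin 3
  colour i = arc N ((k * toℕ i) % (3 * N))
  scaled-shift : ∀ {x y d} → (x + d) % n ≡ y % n → (k * x + k * d) % (3 * N) ≡ (k * y) % (3 * N)
  scaled-shift {x} {y} {d} x+d≡y = trans (cong (_% (3 * N)) (sym (*-distribˡ-+ k x d)))
                                        (%-cong-*ˡ k (3 * N) (%-cong-∣ 3N∣n x+d≡y))
  proper : ∀ i j → Adj n D i j → colour i ≢ colour j
  proper i j (_ , Dd) with cdist⇒shift n i j
  ... | inj₁ i→j = arc-shift-≢ N _ _ _ (scaled-shift i→j) (middle _ Dd)
  ... | inj₂ j→i = arc-shift-≢ N _ _ _ (scaled-shift j→i) (middle _ Dd) ∘ sym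

p-adic-split : ∀ p → 1 < p → ∀ m → 0 < m → ∃₂ λ a m′ → m ≡ p ^ a * m′ × ¬ p ∣ m′
p-adic-split p 1<p m 0<m = split m 0<m (<-wellFounded m)
  where
  split : ∀ m → 0 < m → Acc _<_ m → ∃₂ λ a m′ → m ≡ p ^ a * m′ × ¬ p ∣ m′
  split m 0<m (acc smaller) with p ∣? m
  ... | no p∤m = 0 , m , sym (+-identityʳ m) , p∤m
  ... | yes (divides q refl) with split q 0<q (smaller (m<m*n q p {{q≢0}} 1<p))
    where
    q≢0 : NonZero q
    q≢0 = m*n≢0⇒m≢0 q {{>-nonZero 0<m}}
    0<q : 0 < q
    0<q = >-nonZero⁻¹ q {{q≢0}}
  ...   | a , m′ , refl , p∤m′ =
    suc a , m′ , trans (*-comm (p ^ a * m′) p) (sym (*-assoc p (p ^ a) m′)) , p∤m′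

prime⇒∤⇒coprime : ∀ {p m} → Prime p → ¬ p ∣ m → Coprime m p
prime⇒∤⇒coprime pr p∤m (d∣m , d∣p) with prime⇒irreducible pr d∣p
... | inj₁ d≡1 = d≡1
... | inj₂ refl = contradiction d∣m p∤m

coprime-^ : ∀ {m n} k → Coprime m n → Coprime m (n ^ k)
coprime-^ zero    m⊥n (_ , d∣1) = ∣1⇒≡1 d∣1
coprime-^ (suc k) m⊥n {d} (d∣m , d∣n*n^k) = coprime-^ k m⊥n (d∣m , coprime-divisor d⊥n d∣n*n^k)
  where
  d⊥n : Coprime d _
  d⊥n (e∣d , e∣n) = m⊥n (∣-trans e∣d d∣m , e∣n)

modular-inverse : ∀ m n → 1 < n → Coprime m n → ∃₂ λ x q → x * m ≡ 1 + q * n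
modular-inverse m n@(suc n′) 1<n m⊥n with coprime-Bézout m⊥n
... | Bézout.+- x y 1+yn≡xm = x , y , sym 1+yn≡xm
... | Bézout.-+ x y 1+xm≡yn = n′ * x , n′ * x * m / n , (begin
  n′ * x * m                                ≡⟨ m≡m%n+[m/n]*n (n′ * x * m) n ⟩
  (n′ * x * m) % n + n′ * x * m / n * n     ≡⟨ cong (_+ n′ * x * m / n * n) residue ⟩
  1 + n′ * x * m / n * n                    ∎)
  where
  open ≡-Reasoning
  -- n′ ≡ -1 and x m ≡ -1 modulo n, so n′ x inverts m.
  lift : n′ * x * m + n ≡ 1 + n′ * y * n
  lift = begin
    n′ * x * m + n       ≡⟨ distrib n′ x m ⟩
    n′ * (1 + x * m) + 1 ≡⟨ cong (λ z → n′ * z + 1) 1+xm≡yn ⟩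
    n′ * (y * n) + 1     ≡⟨ reassoc n′ y n ⟩
    1 + n′ * y * n       ∎
    where
    distrib : ∀ a b c → a * b * c + suc a ≡ a * (1 + b * c) + 1
    distrib = solve-∀
    reassoc : ∀ a b c → a * (b * c) + 1 ≡ 1 + a * b * c
    reassoc = solve-∀
  residue : (n′ * x * m) % n ≡ 1
  residue = begin
    (n′ * x * m) % n     ≡⟨ [m+n]%n≡m%n (n′ * x * m) n ⟨
    (n′ * x * m + n) % n ≡⟨ cong (_% n) lift ⟩
    (1 + n′ * y * n) % n ≡⟨ [m+kn]%n≡m%n 1 (n′ * y) n ⟩
    1 % n                ≡⟨ m<n⇒m%n≡m 1<n ⟩
    1                    ∎

p∤p^r+1 : ∀ p → 2 < p → ∀ r → ¬ p ∣ p ^ r + 1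
p∤p^r+1 p 2<p zero    p∣2 = >⇒∤ 2<p p∣2
p∤p^r+1 p 2<p (suc r) p∣p^[1+r]+1 = <⇒≢ (<-trans (n<1+n 1) 2<p) (sym (∣1⇒≡1 p∣1))
  where
  p∣1 : p ∣ 1
  p∣1 = ∣m+n∣m⇒∣n p∣p^[1+r]+1 (m∣m*n (p ^ r))

prime⇒∤* : ∀ {p m n} → Prime p → ¬ p ∣ m → ¬ p ∣ n → ¬ p ∣ m * n
prime⇒∤* pr p∤m p∤n p∣mn = Sum.[ p∤m , p∤n ]′ (euclidsLemma _ _ pr p∣mn)

prime[3] : Prime 3
prime[3] = from-yes (prime? 3)

middle-of-multiple : ∀ N x → ¬ 3 ∣ x → Middle N (x * N)
middle-of-multiple N x 3∤x =
  x / 3 , x % 3 * N , decompose , bounds (x % 3) (m%n<n x 3) (3∤x ∘ m%n≡0⇒n∣m x 3)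
  where
  decompose : x * N ≡ x % 3 * N + x / 3 * (3 * N)
  decompose = trans (cong (_* N) (m≡m%n+[m/n]*n x 3)) (distrib (x % 3) (x / 3) N)
    where
    distrib : ∀ a b N → (a + b * 3) * N ≡ a * N + b * (3 * N)
    distrib = solve-∀
  bounds : ∀ r → r < 3 → r ≢ 0 → N ≤ r * N × r * N ≤ N + N
  bounds 0 _ r≢0 = contradiction refl r≢0
  bounds 1 _ _ = ≤-reflexive (sym (+-identityʳ N)) , +-monoʳ-≤ N z≤n
  bounds 2 _ _ = m≤m+n N (N + 0) , ≤-reflexive (cong (N +_) (+-identityʳ N))
  bounds (suc (suc (suc _))) (s≤s (s≤s (s≤s ()))) _

-- k s ≡ R + 1 (mod 3R) for R = 3^(b-a), so k · 3^a s ≡ 3^b + 3^a (mod 3^(b+1)).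
middle-by-inverse : ∀ {a b s t} x q → a ≤ b → ¬ 3 ∣ t → x * s ≡ 1 + q * (3 * 3 ^ (b ∸ a)) →
                    let k = x * (3 ^ (b ∸ a) + 1) in
                    Middle (3 ^ b) (k * (3 ^ a * s)) × Middle (3 ^ b) (k * (3 ^ b * t))
middle-by-inverse {a} {b} {s} {t} x q a≤b 3∤t xs≡1+qL =
  (q * (R + 1) , N + P , k[Ps]≡N+P , m≤m+n N P , +-monoʳ-≤ N (^-monoʳ-≤ 3 a≤b)) ,
  subst (Middle N) (reassoc (x * (R + 1)) t N) (middle-of-multiple N (x * (R + 1) * t) 3∤kt)
  where
  R P N : ℕ
  R = 3 ^ (b ∸ a)
  P = 3 ^ a
  N = 3 ^ b
  N≡RP : N ≡ R * P
  N≡RP = trans (cong (3 ^_) (sym (m∸n+n≡m a≤b))) (^-distribˡ-+-* 3 (b ∸ a) a)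
  reassoc : ∀ k t N → k * t * N ≡ k * (N * t)
  reassoc = solve-∀
  3∤x : ¬ 3 ∣ x
  3∤x 3∣x = contradiction (∣1⇒≡1 3∣1) λ ()
    where
    3∣1+qL : 3 ∣ 1 + q * (3 * R)
    3∣1+qL = subst (3 ∣_) xs≡1+qL (∣m⇒∣m*n s 3∣x)
    3∣1 : 3 ∣ 1
    3∣1 = ∣m+n∣m⇒∣n (subst (3 ∣_) (+-comm 1 (q * (3 * R))) 3∣1+qL) (∣n⇒∣m*n q (m∣m*n R))
  3∤kt : ¬ 3 ∣ x * (R + 1) * t
  3∤kt = prime⇒∤* prime[3] (prime⇒∤* prime[3] 3∤x (p∤p^r+1 3 ≤-refl (b ∸ a))) 3∤t
  k[Ps]≡N+P : x * (R + 1) * (P * s) ≡ N + P + q * (R + 1) * (3 * N)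
  k[Ps]≡N+P = begin
    x * (R + 1) * (P * s)                   ≡⟨ pull-out x s (R + 1) P ⟩
    P * (R + 1) * (x * s)                   ≡⟨ cong (P * (R + 1) *_) xs≡1+qL ⟩
    P * (R + 1) * (1 + q * (3 * R))         ≡⟨ expand P R q ⟩
    R * P + P + q * (R + 1) * (3 * (R * P)) ≡⟨ cong (λ Z → Z + P + q * (R + 1) * (3 * Z)) N≡RP ⟨
    N + P + q * (R + 1) * (3 * N)           ∎
    where
    open ≡-Reasoning
    pull-out : ∀ x s A P → x * A * (P * s) ≡ P * A * (x * s)
    pull-out = solve-∀
    expand : ∀ P R q →
             P * (R + 1) * (1 + q * (3 * R)) ≡ R * P + P + q * (R + 1) * (3 * (R * P))
    expand = solve-∀

multiplier : ∀ {a b s t} → a ≤ b → ¬ 3 ∣ s → ¬ 3 ∣ t →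
             ∃ λ k → Middle (3 ^ b) (k * (3 ^ a * s)) × Middle (3 ^ b) (k * (3 ^ b * t))
multiplier {a} {b} {s} a≤b 3∤s 3∤t with modular-inverse s (3 ^ suc (b ∸ a)) 1<3^[1+r] s⊥3^[1+r]
  where
  1<3^[1+r] : 1 < 3 ^ suc (b ∸ a)
  1<3^[1+r] = ^-monoʳ-< 3 (s≤s (s≤s z≤n)) {0} {suc (b ∸ a)} (s≤s z≤n)
  s⊥3^[1+r] : Coprime s (3 ^ suc (b ∸ a))
  s⊥3^[1+r] = coprime-^ (suc (b ∸ a)) (prime⇒∤⇒coprime prime[3] 3∤s)
... | x , q , xs≡1+qL = x * (3 ^ (b ∸ a) + 1) , middle-by-inverse x q a≤b 3∤t xs≡1+qL

^-cancelʳ-< : ∀ p .{{_ : NonZero p}} {c u} → p ^ c < p ^ u → c < u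
^-cancelʳ-< p p^c<p^u = ≰⇒> (λ u≤c → <⇒≱ p^c<p^u (^-monoʳ-≤ p u≤c))

^-monoʳ-∣ : ∀ p {c u} → c ≤ u → p ^ c ∣ p ^ u
^-monoʳ-∣ p {c} {u} c≤u =
  divides (p ^ (u ∸ c)) (trans (cong (p ^_) (sym (m∸n+n≡m c≤u))) (^-distribˡ-+-* p (u ∸ c) c))

2*m≤n⇒m<n : ∀ {m n} → 0 < m → 2 * m ≤ n → m < n
2*m≤n⇒m<n {m} 0<m 2m≤n = <-≤-trans (m<m+n m (≤-trans 0<m (m≤m+n m 0))) 2m≤n

2*m≤n⇒m≤n∸m : ∀ {m n} → 2 * m ≤ n → m ≤ n ∸ m
2*m≤n⇒m≤n∸m {m} 2m≤n = m+n≤o⇒m≤o∸n m (≤-trans (+-monoʳ-≤ m (m≤m+n m 0)) 2m≤n)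

exponent-< : ∀ p .{{_ : NonZero p}} {c x u} → 0 < p ^ c * x → 2 * (p ^ c * x) ≤ p ^ u → c < u
exponent-< p {c} {x} {u} 0<p^cx 2p^cx≤p^u = ^-cancelʳ-< p (begin-strict
  p ^ c     ≤⟨ m≤m*n (p ^ c) x {{m*n≢0⇒n≢0 (p ^ c) {{>-nonZero 0<p^cx}}}} ⟩
  p ^ c * x <⟨ 2*m≤n⇒m<n 0<p^cx 2p^cx≤p^u ⟩
  p ^ u     ∎)
  where open ≤-Reasoning

pair-colorable-by-arcs : ∀ u c {s t} k → c < u → Middle (3 ^ c) (k * s) → Middle (3 ^ c) (k * t) →
                         Colorable (3 ^ u) (Pair s t) 3
pair-colorable-by-arcs u c {s} {t} k c<u middle-s middle-t =
  colorable-by-arcs (3 ^ u) (Pair s t) (3 ^ c) k {{m^n≢0 3 u}} {{m^n≢0 3 (suc c)}} (^-monoʳ-∣ 3 c<u) middle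
  where
  middle : ∀ d → Pair s t d → Middle (3 ^ c) (k * d)
  middle d (inj₁ refl) = middle-s
  middle d (inj₂ refl) = middle-t

three-colorable : ∀ u s t → 0 < s → 0 < t → 2 * s ≤ 3 ^ u → 2 * t ≤ 3 ^ u →
                  Colorable (3 ^ u) (Pair s t) 3
three-colorable u s t 0<s 0<t 2s≤n 2t≤n
  with p-adic-split 3 (s≤s (s≤s z≤n)) s 0<s | p-adic-split 3 (s≤s (s≤s z≤n)) t 0<t
... | a , s′ , refl , 3∤s′ | b , t′ , refl , 3∤t′ with ≤-total a b
...   | inj₁ a≤b = let k , middle-s , middle-t = multiplier a≤b 3∤s′ 3∤t′ in
                   pair-colorable-by-arcs u b k (exponent-< 3 0<t 2t≤n) middle-s middle-t
...   | inj₂ b≤a = let k , middle-t , middle-s = multiplier b≤a 3∤t′ 3∤s′ in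
                   pair-colorable-by-arcs u a k (exponent-< 3 0<s 2s≤n) middle-s middle-t

flip : Fin 2 → Fin 2
flip zero       = suc zero
flip (suc zero) = zero

flip-involutive : ∀ a → flip (flip a) ≡ a
flip-involutive zero       = refl
flip-involutive (suc zero) = refl

flip-≢ : ∀ a → flip a ≢ a
flip-≢ zero       ()
flip-≢ (suc zero) ()

≢⇒≡flip : ∀ {a b : Fin 2} → a ≢ b → b ≡ flip a
≢⇒≡flip {zero}     {zero}     a≢b = contradiction refl a≢b
≢⇒≡flip {zero}     {suc zero} _   = refl
≢⇒≡flip {suc zero} {zero}     _   = refl
≢⇒≡flip {suc zero} {suc zero} a≢b = contradiction refl a≢b

fold-flip-even : ∀ a h → fold a flip (h + h) ≡ a
fold-flip-even a zero    = refl
fold-flip-even a (suc h) rewrite +-suc h h = trans (flip-involutive _) (fold-flip-even a h)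

3^u-odd : ∀ u → ∃ λ h → 3 ^ u ≡ suc (h + h)
3^u-odd zero = 0 , refl
3^u-odd (suc u) with 3^u-odd u
... | h , 3^u≡1+2h = 1 + 3 * h , trans (cong (3 *_) 3^u≡1+2h) (triple h)
  where
  triple : ∀ h → 3 * suc (h + h) ≡ suc ((1 + 3 * h) + (1 + 3 * h))
  triple = solve-∀

Colorable-mono : ∀ {n D k m} → k ≤ m → Colorable n D k → Colorable n D m
Colorable-mono k≤m (c , proper) =
  (λ i → inject≤ (c i) k≤m) , λ i j adj → proper i j adj ∘ inject≤-injective k≤m k≤m (c i) (c j)

odd-¬2-colorable : ∀ n D s → (∃ λ h → n ≡ suc (h + h)) → 0 < s → s ≤ n ∸ s → D s →
                   ¬ Colorable n D 2
odd-¬2-colorable n D s (h , refl) 0<s s≤n∸s Ds (c , proper) = flip-≢ (c (walk 0)) closes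
  where
  walk : ℕ → Fin n
  walk j = fromℕ< (m%n<n (j * s) n)
  step : ∀ j → toℕ (walk (suc j)) ≡ (toℕ (walk j) + s) % n
  step j = begin
    toℕ (walk (suc j))        ≡⟨ toℕ-fromℕ< (m%n<n (suc j * s) n) ⟩
    (s + j * s) % n           ≡⟨ cong (_% n) (+-comm s (j * s)) ⟩
    (j * s + s) % n           ≡⟨ [m%n+o]%n≡[m+o]%n (j * s) n s ⟨
    ((j * s) % n + s) % n     ≡⟨ cong (λ z → (z + s) % n) (toℕ-fromℕ< (m%n<n (j * s) n)) ⟨
    (toℕ (walk j) + s) % n    ∎
    where open ≡-Reasoning
  adjacent : ∀ j → Adj n D (walk j) (walk (suc j))
  adjacent j = cdist≢0⇒≢ n _ _ (λ d≡0 → <⇒≢ 0<s (trans (sym d≡0) d≡s)) , subst D (sym d≡s) Ds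
    where
    d≡s : cdist n (walk j) (walk (suc j)) ≡ s
    d≡s = shift⇒cdist n s (walk j) (walk (suc j)) s≤n∸s (step j)
  alternates : ∀ j → c (walk j) ≡ fold (c (walk 0)) flip j
  alternates zero    = refl
  alternates (suc j) = trans (≢⇒≡flip (proper _ _ (adjacent j))) (cong flip (alternates j))
  walk-closes : walk n ≡ walk 0
  walk-closes = toℕ-injective (begin
    toℕ (walk n)  ≡⟨ toℕ-fromℕ< (m%n<n (n * s) n) ⟩
    (n * s) % n   ≡⟨ cong (_% n) (*-comm n s) ⟩
    (s * n) % n   ≡⟨ m*n%n≡0 s n ⟩
    toℕ (walk 0)  ∎)
    where open ≡-Reasoning
  closes : flip (c (walk 0)) ≡ c (walk 0)
  closes = begin
    flip (c (walk 0))                          ≡⟨ cong flip (fold-flip-even (c (walk 0)) h) ⟨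
    flip (fold (c (walk 0)) flip (h + h))      ≡⟨ alternates n ⟨
    c (walk n)                                 ≡⟨ cong c walk-closes ⟩
    c (walk 0)                                 ∎
    where open ≡-Reasoning

theorem3p3p3 : (u s t : ℕ) → 1 < u → 1 ≤ s → 1 ≤ t → 2 * s ≤ 3 ^ u → 2 * t ≤ 3 ^ u → s ≢ t →
    ChromaticNumber (3 ^ u) (Pair s t) 3
theorem3p3p3 u s t _ 0<s 0<t 2s≤n 2t≤n _ = three-colorable u s t 0<s 0<t 2s≤n 2t≤n , fewer
  where
  fewer : ∀ m → m < 3 → ¬ Colorable (3 ^ u) (Pair s t) m
  fewer m (s≤s m≤2) =
    odd-¬2-colorable (3 ^ u) (Pair s t) s (3^u-odd u) 0<s (2*m≤n⇒m≤n∸m 2s≤n) (inj₁ refl)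
    ∘ Colorable-mono {D = Pair s t} m≤2
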